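{- Let $\lambda>1$, $\epsilon>0$, $f>0$, let $T$ be a $\lambda$-HST of depth $L\ge\log_\lambda(\epsilon f)$ with leaf set $V$, and let $\vec N\in\mathbb{Z}_{\ge0}^V$. Let $L'=\max\{0,\lceil\log_\lambda(\epsilon f)\rceil\}$, $M=\{v\in V_T:\ \ell(v)\ge L'\text{ or }N_v\lambda^{\ell(v)}\ge f\}$, $R=\mathrm{min\text{ - }set}(M)$, and let $S\subseteq R$ be the set of vertices of $R$ that are nearest (in $d_T$) to at least one leaf $v$ with $N_v\ge1$, each such client being connected to its nearest vertex of $R$. Then the connection cost $\sum_{v\in V}N_v d_T(v,S)$ is at most $O(1)\cdot\mathrm{opt}$, where the constant depends only on $\lambda$.
   Context: A $\lambda$-HST of depth $L$ is an edge-weighted rooted tree in which every root-to-leaf path has exactly $L$ edges; the level $\ell(v)$ of a vertex is $L$ minus its depth, and an edge between levels $\ell$ and $\ell+1$ has weight $\lambda^\ell$. $V_T$ is its vertex set and $d_T$ its shortest-path distance. For a non-leaf $u$, $N_u$ is the total number of clients at leaves of the subtree $T_u$. For $M\subseteq V_T$, $\mathrm{min\text{ - }set}(M)=\{u\in M: T_u\setminus\{u\}\text{ contains no vertex of }M\}$. $\mathrm{opt}$ is the minimum over $S\subseteq V_T$ of $|S|f+\sum_{v\in V}N_v d_T(v,S)$.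
   Formalization: The parameters λ, ε and f range over the rationals. -}

module Defs where

open import Data.Nat as ℕ using (ℕ; zero; suc)
import Data.Nat.Properties as ℕP
open import Data.Integer using (+_)
open import Data.Nat.ListAction using () renaming (sum to sumℕ)
open import Data.Fin using (Fin; _≟_)
open import Data.List using (List; []; _∷_; map; concat; filter; length; foldr; allFin)
open import Data.Rational using (ℚ; 0ℚ; 1ℚ; _+_; _*_; _⊓_; _≤_; _/_)
open import Data.Rational.Properties using (_≤?_)
open import Data.Product using (_×_)
open import Data.Sum using (_⊎_)
open import Data.List.Relation.Unary.All using (All; all?)
open import Data.List.Relation.Unary.Any using (Any; any?)
open import Relation.Nullary using (Dec; yes; no; ¬_)
open import Relation.Nullary.Decidable using (_×-dec_; _⊎-dec_; ¬?)
open import Relation.Binary.PropositionalEquality using (_≡_; refl)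

ℕ→ℚ : ℕ → ℚ
ℕ→ℚ n = (+ n) / 1

_^ℚ_ : ℚ → ℕ → ℚ
x ^ℚ zero = 1ℚ
x ^ℚ suc n = x * (x ^ℚ n)

sumℚ : List ℚ → ℚ
sumℚ = foldr _+_ 0ℚ

-- A tree of depth L in which every root-to-leaf path has exactly L edges.
-- Index = level of the root (leaves have level 0).  Each leaf carries its number of
-- clients N_v.
data Tree : ℕ → Set where
  leaf : ℕ → Tree 0
  node : ∀ {L k} → (Fin (suc k) → Tree L) → Tree (suc L)

-- vertices of a tree, as paths from the root
data Pos : ∀ {L} → Tree L → Set where
  here  : ∀ {L} {t : Tree L} → Pos t
  child : ∀ {L k} {ts : Fin (suc k) → Tree L} (i : Fin (suc k)) → Pos (ts i) → Pos (node ts)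

lvl : ∀ {L} {t : Tree L} → Pos t → ℕ
lvl {L} here = L
lvl (child i p) = lvl p

clients : ∀ {L} → Tree L → ℕ
clients (leaf n) = n
clients (node {k = k} ts) = sumℕ (map (λ i → clients (ts i)) (allFin (suc k)))

-- N_u : number of clients at the leaves of the subtree T_u (for a leaf: N_v)
Ncl : ∀ {L} (t : Tree L) → Pos t → ℕ
Ncl t here = clients t
Ncl (node ts) (child i p) = Ncl (ts i) p

allPos : ∀ {L} (t : Tree L) → List (Pos t)
properPos : ∀ {L} (t : Tree L) → List (Pos t)
allPos t = here ∷ properPos t
properPos (leaf n) = []
properPos (node {k = k} ts) = concat (map (λ i → map (child i) (allPos (ts i))) (allFin (suc k)))

strictDesc : ∀ {L} {t : Tree L} → Pos t → List (Pos t)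
strictDesc {t = t} here = properPos t
strictDesc (child i p) = map (child i) (strictDesc p)

leaves : ∀ {L} (t : Tree L) → List (Pos t)
leaves t = filter (λ p → lvl p ℕ.≟ 0) (allPos t)

-- HST edge weights: edge between levels ℓ and ℓ+1 has weight lam^ℓ.
-- distance from the root of t down to a vertex
rootDist : (lam : ℚ) → ∀ {L} (t : Tree L) → Pos t → ℚ
rootDist lam t here = 0ℚ
rootDist lam (node {L} ts) (child i p) = (lam ^ℚ L) + rootDist lam (ts i) p

dist : (lam : ℚ) → ∀ {L} (t : Tree L) → Pos t → Pos t → ℚ
dist lam t here q = rootDist lam t q
dist lam t (child i p) here = rootDist lam t (child i p)
dist lam (node ts) (child i p) (child j q) with i ≟ j
... | yes refl = dist lam (ts i) p q
... | no _ = rootDist lam (node ts) (child i p) + rootDist lam (node ts) (child j q)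

-- d_T(v, S) = min_{s ∈ S} d_T(v, s)  (only used for nonempty S; 0 for [])
distSet : (lam : ℚ) → ∀ {L} (t : Tree L) → Pos t → List (Pos t) → ℚ
distSet lam t v [] = 0ℚ
distSet lam t v (s ∷ ss) = go (dist lam t v s) ss
  where
  go : ℚ → List (Pos t) → ℚ
  go m [] = m
  go m (x ∷ xs) = go (m ⊓ dist lam t v x) xs

connCost : (lam : ℚ) → ∀ {L} (t : Tree L) → List (Pos t) → ℚ
connCost lam t S = sumℚ (map (λ v → ℕ→ℚ (Ncl t v) * distSet lam t v S) (leaves t))

facCost : (lam f : ℚ) → ∀ {L} (t : Tree L) → List (Pos t) → ℚ
facCost lam f t S = (ℕ→ℚ (length S) * f) + connCost lam t S

-- L' = max{0, ⌈log_lam(εf)⌉}, characterised as the least k ∈ ℕ with lam^k ≥ εf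
IsLPrime : (lam ε f : ℚ) → ℕ → Set
IsLPrime lam ε f L' = (ε * f ≤ lam ^ℚ L') × (∀ k → k ℕ.< L' → ¬ (ε * f ≤ lam ^ℚ k))

InM : (lam f : ℚ) (L' : ℕ) → ∀ {L} (t : Tree L) → Pos t → Set
InM lam f L' t u = (L' ℕ.≤ lvl u) ⊎ (f ≤ ℕ→ℚ (Ncl t u) * (lam ^ℚ lvl u))

inM? : (lam f : ℚ) (L' : ℕ) → ∀ {L} (t : Tree L) → (u : Pos t) → Dec (InM lam f L' t u)
inM? lam f L' t u = (L' ℕP.≤? lvl u) ⊎-dec (f ≤? (ℕ→ℚ (Ncl t u) * (lam ^ℚ lvl u)))

minSetM : (lam f : ℚ) (L' : ℕ) → ∀ {L} (t : Tree L) → List (Pos t)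
minSetM lam f L' t =
  filter (λ u → inM? lam f L' t u ×-dec all? (λ w → ¬? (inM? lam f L' t w)) (strictDesc u)) (allPos t)

nearestUsed : (lam : ℚ) → ∀ {L} (t : Tree L) → List (Pos t) → List (Pos t)
nearestUsed lam t R =
  filter (λ r → any? (λ v → (1 ℕP.≤? Ncl t v) ×-dec all? (λ r' → dist lam t v r ≤? dist lam t v r') R) (leaves t)) R

module Submission where

-- Write δ = lam - 1, and let Φ(T) be the sum of N_u lam^ℓ(u) over the vertices u ∉ M whose
-- parent lies in M; the root lies in M because L' ≤ L. On one hand Φ(T) ≤ opt: for each such u,
-- a solution either opens a facility inside T_u, paying f > N_u lam^ℓ(u), or routes every client
-- of T_u across the edge of weight lam^ℓ(u) above u. On the other hand δ · cost ≤ 2 lam Φ(T): a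
-- client leaf is either itself in min-set(M) or lies in such a T_u, and then some vertex of
-- min-set(M) below the parent of u is within 2 (1 + lam + … + lam^ℓ(u)) ≤ 2 lam^(ℓ(u)+1) / δ; the
-- set S contains the client's nearest vertex of R. Hence C = 2 lam / δ.

open import Defs
open import Data.Nat using (ℕ)
open import Data.List using (List; [])
open import Data.Rational using (ℚ; 0ℚ; 1ℚ; _<_; _≤_; _*_)
open import Data.Product using (∃-syntax)
open import Data.Sum using (_⊎_)
open import Relation.Binary.PropositionalEquality using (_≡_; _≢_)

open import Algebra.Bundles using (CommutativeRing)
open import Data.Empty using (⊥-elim)
open import Data.Fin using (Fin; _≟_)
open import Data.Fin.Properties using (punchInᵢ≢i)
open import Data.Vec.Functional using (removeAt)
import Data.Integer as ℤ
import Data.Integer.Properties as ℤP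
open import Data.List using (_∷_; _++_; map; concat; filter; allFin; tabulate; length)
import Data.List.Properties as ListP
open import Data.List.Membership.Propositional using (_∈_; lose)
import Data.List.Membership.Propositional.Properties as ∈P
open import Data.List.Relation.Unary.All using (All; []; _∷_)
import Data.List.Relation.Unary.All as All
import Data.List.Relation.Unary.All.Properties as AllP
open import Data.List.Relation.Unary.Any using (here; there; any?; satisfied)
open import Data.Nat as ℕ using (zero; suc)
open import Data.Nat.Coprimality using (1-coprimeTo) renaming (sym to coprime-sym)
open import Data.Nat.ListAction using () renaming (sum to sumℕ)
import Data.Nat.Properties as ℕP
open import Data.Product using (Σ; _×_; _,_; proj₁; proj₂)
open import Data.Rational using (mkℚ; _+_; _-_; -_; _⊓_; 1/_; Positive; NonZero; positive; nonNegative)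
import Data.Rational.Properties as ℚP
open import Data.Rational.Solver using (module +-*-Solver)
open import Data.Sum using (inj₁; inj₂; [_,_]′)
open import Function using (_∘_; id; const)
open import Relation.Nullary using (Dec; yes; no; ¬_)
open import Relation.Nullary.Decidable using (_×-dec_; ¬?)
open import Relation.Binary.Bundles using (DecTotalOrder)
open import Relation.Binary.PropositionalEquality using (refl; sym; trans; cong; cong₂; subst; module ≡-Reasoning)

open import Algebra.Properties.CommutativeSemigroup
  (CommutativeRing.*-commutativeSemigroup ℚP.+-*-commutativeRing) using (x∙yz≈y∙xz)
open import Algebra.Properties.Semiring.Sum (CommutativeRing.semiring ℚP.+-*-commutativeRing)
  using (sum; sum-cong-≗; sum-remove; sum-replicate-zero; *-distribˡ-sum; *-distribʳ-sum; ∑-distrib-+)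
open import Data.List.Extrema (DecTotalOrder.totalOrder ℚP.≤-decTotalOrder)
  using (argmin; argmin-sel; f[argmin]≤f[xs])

*-monoˡ-≤-0≤ : ∀ {r p q} → 0ℚ ≤ r → p ≤ q → r * p ≤ r * q
*-monoˡ-≤-0≤ {r} 0≤r = ℚP.*-monoˡ-≤-nonNeg r {{nonNegative 0≤r}}

*-monoʳ-≤-0≤ : ∀ {r p q} → 0ℚ ≤ r → p ≤ q → p * r ≤ q * r
*-monoʳ-≤-0≤ {r} 0≤r = ℚP.*-monoʳ-≤-nonNeg r {{nonNegative 0≤r}}

0≤* : ∀ {p q} → 0ℚ ≤ p → 0ℚ ≤ q → 0ℚ ≤ p * q
0≤* {p} 0≤p 0≤q = ℚP.≤-trans (ℚP.≤-reflexive (sym (ℚP.*-zeroʳ p))) (*-monoˡ-≤-0≤ 0≤p 0≤q)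

p≤p+q : ∀ {p q} → 0ℚ ≤ q → p ≤ p + q
p≤p+q {p} 0≤q = ℚP.≤-trans (ℚP.≤-reflexive (sym (ℚP.+-identityʳ p))) (ℚP.+-monoʳ-≤ p 0≤q)

p≤q+p : ∀ {p q} → 0ℚ ≤ q → p ≤ q + p
p≤q+p {p} 0≤q = ℚP.≤-trans (ℚP.≤-reflexive (sym (ℚP.+-identityˡ p))) (ℚP.+-monoˡ-≤ p 0≤q)

0≤1 : 0ℚ ≤ 1ℚ
0≤1 = ℚP.nonNegative⁻¹ 1ℚ

ℕ→ℚ≡mkℚ : ∀ n → ℕ→ℚ n ≡ mkℚ (ℤ.+ n) 0 (coprime-sym (1-coprimeTo n))
ℕ→ℚ≡mkℚ n = ℚP.normalize-coprime (coprime-sym (1-coprimeTo n))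

ℕ→ℚ-+ : ∀ m n → ℕ→ℚ (m ℕ.+ n) ≡ ℕ→ℚ m + ℕ→ℚ n
ℕ→ℚ-+ m n rewrite ℕ→ℚ≡mkℚ m | ℕ→ℚ≡mkℚ n =
  ℚP./-cong (trans (ℤP.pos-+ m n) (sym (cong₂ ℤ._+_ (ℤP.*-identityʳ (ℤ.+ m)) (ℤP.*-identityʳ (ℤ.+ n))))) refl

0≤ℕ→ℚ : ∀ n → 0ℚ ≤ ℕ→ℚ n
0≤ℕ→ℚ n = ℚP.nonNegative⁻¹ (ℕ→ℚ n) {{ℚP.normalize-nonNeg n 1}}

ℕ→ℚ-mono-≤ : ∀ {m n} → m ℕ.≤ n → ℕ→ℚ m ≤ ℕ→ℚ n
ℕ→ℚ-mono-≤ {m} m≤n with ℕP.m≤n⇒∃[o]m+o≡n m≤n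
... | o , refl = subst (ℕ→ℚ m ≤_) (sym (ℕ→ℚ-+ m o)) (p≤p+q (0≤ℕ→ℚ o))

ℕ→ℚ-sum : ∀ ns → ℕ→ℚ (sumℕ ns) ≡ sumℚ (map ℕ→ℚ ns)
ℕ→ℚ-sum [] = refl
ℕ→ℚ-sum (n ∷ ns) = trans (ℕ→ℚ-+ n (sumℕ ns)) (cong (ℕ→ℚ n +_) (ℕ→ℚ-sum ns))

ℕ→ℚ-*-monoʳ-≤ : ∀ n {p q} → (1 ℕ.≤ n → p ≤ q) → ℕ→ℚ n * p ≤ ℕ→ℚ n * q
ℕ→ℚ-*-monoʳ-≤ zero {p} {q} _ = ℚP.≤-reflexive (trans (ℚP.*-zeroˡ p) (sym (ℚP.*-zeroˡ q)))
ℕ→ℚ-*-monoʳ-≤ (suc n) p≤q = *-monoˡ-≤-0≤ (0≤ℕ→ℚ (suc n)) (p≤q (ℕ.s≤s ℕ.z≤n))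

∈⇒≤sumℕ : ∀ {n ns} → n ∈ ns → n ℕ.≤ sumℕ ns
∈⇒≤sumℕ (here refl) = ℕP.m≤m+n _ _
∈⇒≤sumℕ (there n∈ns) = ℕP.≤-trans (∈⇒≤sumℕ n∈ns) (ℕP.m≤n+m _ _)

sumℚ-++ : ∀ xs ys → sumℚ (xs ++ ys) ≡ sumℚ xs + sumℚ ys
sumℚ-++ [] ys = sym (ℚP.+-identityˡ (sumℚ ys))
sumℚ-++ (x ∷ xs) ys = trans (cong (x +_) (sumℚ-++ xs ys)) (sym (ℚP.+-assoc x (sumℚ xs) (sumℚ ys)))

sumℚ-map-concat : ∀ {A : Set} (g : A → ℚ) xss →
  sumℚ (map g (concat xss)) ≡ sumℚ (map (sumℚ ∘ map g) xss)
sumℚ-map-concat g [] = refl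
sumℚ-map-concat g (xs ∷ xss) = begin
  sumℚ (map g (xs ++ concat xss))              ≡⟨ cong sumℚ (ListP.map-++ g xs (concat xss)) ⟩
  sumℚ (map g xs ++ map g (concat xss))        ≡⟨ sumℚ-++ (map g xs) _ ⟩
  sumℚ (map g xs) + sumℚ (map g (concat xss))  ≡⟨ cong (sumℚ (map g xs) +_) (sumℚ-map-concat g xss) ⟩
  sumℚ (map g xs) + sumℚ (map (sumℚ ∘ map g) xss) ∎
  where open ≡-Reasoning

sumℚ-map-*ˡ : ∀ {A : Set} c (g : A → ℚ) xs → sumℚ (map (λ x → c * g x) xs) ≡ c * sumℚ (map g xs)
sumℚ-map-*ˡ c g [] = sym (ℚP.*-zeroʳ c)
sumℚ-map-*ˡ c g (x ∷ xs) =
  trans (cong (c * g x +_) (sumℚ-map-*ˡ c g xs)) (sym (ℚP.*-distribˡ-+ c (g x) (sumℚ (map g xs))))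

sumℚ-map-mono-≤ : ∀ {A : Set} {g h : A → ℚ} xs → (∀ {x} → x ∈ xs → g x ≤ h x) →
  sumℚ (map g xs) ≤ sumℚ (map h xs)
sumℚ-map-mono-≤ [] _ = ℚP.≤-refl
sumℚ-map-mono-≤ (x ∷ xs) g≤h = ℚP.+-mono-≤ (g≤h (here refl)) (sumℚ-map-mono-≤ xs (g≤h ∘ there))

sumℚ-tabulate : ∀ {n} (F : Fin n → ℚ) → sumℚ (tabulate F) ≡ sum F
sumℚ-tabulate {zero} F = refl
sumℚ-tabulate {suc n} F = cong (F Fin.zero +_) (sumℚ-tabulate (F ∘ Fin.suc))

sumℚ-map-allFin : ∀ {n} (F : Fin n → ℚ) → sumℚ (map F (allFin n)) ≡ sum F
sumℚ-map-allFin F = trans (cong sumℚ (ListP.map-tabulate id F)) (sumℚ-tabulate F)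

sum-mono-≤ : ∀ {n} {F G : Fin n → ℚ} → (∀ i → F i ≤ G i) → sum F ≤ sum G
sum-mono-≤ {zero} _ = ℚP.≤-refl
sum-mono-≤ {suc n} F≤G = ℚP.+-mono-≤ (F≤G Fin.zero) (sum-mono-≤ (F≤G ∘ Fin.suc))

filter-concat : ∀ {A : Set} {P : A → Set} (P? : ∀ x → Dec (P x)) xss →
  filter P? (concat xss) ≡ concat (map (filter P?) xss)
filter-concat P? [] = refl
filter-concat P? (xs ∷ xss) =
  trans (ListP.filter-++ P? xs (concat xss)) (cong (filter P? xs ++_) (filter-concat P? xss))

filter-map : ∀ {A B : Set} {P : B → Set} (P? : ∀ x → Dec (P x)) (f : A → B) xs →
  filter P? (map f xs) ≡ map f (filter (P? ∘ f) xs)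
filter-map P? f [] = refl
filter-map P? f (x ∷ xs) with P? (f x)
... | yes _ = cong (f x ∷_) (filter-map P? f xs)
... | no _ = filter-map P? f xs

∈-allPos : ∀ {L} (t : Tree L) (p : Pos t) → p ∈ allPos t
∈-allPos t here = here refl
∈-allPos (node ts) (child i p) =
  there (∈P.∈-concat⁺′ (∈P.∈-map⁺ (child i) (∈-allPos (ts i) p))
                       (∈P.∈-map⁺ (λ j → map (child j) (allPos (ts j))) (∈P.∈-allFin i)))

isLeaf? : ∀ {L} {t : Tree L} (p : Pos t) → Dec (lvl p ≡ 0)
isLeaf? p = lvl p ℕ.≟ 0

∈-leaves⁺ : ∀ {L} {t : Tree L} {p : Pos t} → lvl p ≡ 0 → p ∈ leaves t
∈-leaves⁺ {t = t} {p} isLeaf = ∈P.∈-filter⁺ isLeaf? (∈-allPos t p) isLeaf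

∈-leaves⁻ : ∀ {L} {t : Tree L} {p : Pos t} → p ∈ leaves t → lvl p ≡ 0
∈-leaves⁻ {t = t} p∈leaves = proj₂ (∈P.∈-filter⁻ isLeaf? {xs = allPos t} p∈leaves)

leaves-node : ∀ {L k} (ts : Fin (suc k) → Tree L) →
  leaves (node ts) ≡ concat (map (λ i → map (child i) (leaves (ts i))) (allFin (suc k)))
leaves-node {k = k} ts = begin
  filter isLeaf? (concat (map subtree (allFin (suc k))))
    ≡⟨ filter-concat isLeaf? (map subtree (allFin (suc k))) ⟩
  concat (map (filter isLeaf?) (map subtree (allFin (suc k))))
    ≡⟨ cong concat (sym (ListP.map-∘ (allFin (suc k)))) ⟩
  concat (map (filter isLeaf? ∘ subtree) (allFin (suc k)))
    ≡⟨ cong concat (ListP.map-cong (λ i → filter-map isLeaf? (child i) (allPos (ts i))) (allFin (suc k))) ⟩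
  concat (map (λ i → map (child i) (leaves (ts i))) (allFin (suc k))) ∎
  where
  open ≡-Reasoning
  subtree : (i : Fin (suc k)) → List (Pos (node ts))
  subtree i = map (child i) (allPos (ts i))

Ncl≤clients : ∀ {L} (t : Tree L) (p : Pos t) → Ncl t p ℕ.≤ clients t
Ncl≤clients t here = ℕP.≤-refl
Ncl≤clients (node ts) (child i p) =
  ℕP.≤-trans (Ncl≤clients (ts i) p) (∈⇒≤sumℕ (∈P.∈-map⁺ (clients ∘ ts) (∈P.∈-allFin i)))

ℕ→ℚ-clients-node : ∀ {L k} (ts : Fin (suc k) → Tree L) →
  ℕ→ℚ (clients (node ts)) ≡ sum (λ i → ℕ→ℚ (clients (ts i)))
ℕ→ℚ-clients-node {k = k} ts = begin
  ℕ→ℚ (sumℕ (map (clients ∘ ts) (allFin (suc k))))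
    ≡⟨ ℕ→ℚ-sum (map (clients ∘ ts) (allFin (suc k))) ⟩
  sumℚ (map ℕ→ℚ (map (clients ∘ ts) (allFin (suc k))))
    ≡⟨ cong sumℚ (sym (ListP.map-∘ {g = ℕ→ℚ} {f = clients ∘ ts} (allFin (suc k)))) ⟩
  sumℚ (map (ℕ→ℚ ∘ clients ∘ ts) (allFin (suc k)))
    ≡⟨ sumℚ-map-allFin (ℕ→ℚ ∘ clients ∘ ts) ⟩
  sum (ℕ→ℚ ∘ clients ∘ ts)                               ∎
  where open ≡-Reasoning

leafSum : ∀ {L} (t : Tree L) → (Pos t → ℚ) → ℚ
leafSum t g = sumℚ (map g (leaves t))

leafSum-node : ∀ {L k} (ts : Fin (suc k) → Tree L) (g : Pos (node ts) → ℚ) →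
  leafSum (node ts) g ≡ sum (λ i → leafSum (ts i) (g ∘ child i))
leafSum-node {k = k} ts g = begin
  sumℚ (map g (leaves (node ts)))
    ≡⟨ cong (sumℚ ∘ map g) (leaves-node ts) ⟩
  sumℚ (map g (concat (map childLeaves (allFin (suc k)))))
    ≡⟨ sumℚ-map-concat g (map childLeaves (allFin (suc k))) ⟩
  sumℚ (map (sumℚ ∘ map g) (map childLeaves (allFin (suc k))))
    ≡⟨ cong sumℚ (sym (ListP.map-∘ {g = sumℚ ∘ map g} {f = childLeaves} (allFin (suc k)))) ⟩
  sumℚ (map (sumℚ ∘ map g ∘ childLeaves) (allFin (suc k)))
    ≡⟨ cong sumℚ (ListP.map-cong (λ i → cong sumℚ (sym (ListP.map-∘ (leaves (ts i))))) (allFin (suc k))) ⟩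
  sumℚ (map subtreeSum (allFin (suc k)))
    ≡⟨ sumℚ-map-allFin subtreeSum ⟩
  sum subtreeSum ∎
  where
  open ≡-Reasoning
  childLeaves : (i : Fin (suc k)) → List (Pos (node ts))
  childLeaves i = map (child i) (leaves (ts i))
  subtreeSum : Fin (suc k) → ℚ
  subtreeSum i = leafSum (ts i) (g ∘ child i)

weightedCost : ∀ {L} (t : Tree L) → (Pos t → ℚ) → ℚ
weightedCost t h = leafSum t (λ p → ℕ→ℚ (Ncl t p) * h p)

weightedCost-node : ∀ {L k} (ts : Fin (suc k) → Tree L) (h : Pos (node ts) → ℚ) →
  weightedCost (node ts) h ≡ sum (λ i → weightedCost (ts i) (h ∘ child i))
weightedCost-node ts h = leafSum-node ts _

weightedCost-mono-≤ : ∀ {L} (t : Tree L) {h h' : Pos t → ℚ} →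
  (∀ p → lvl p ≡ 0 → 1 ℕ.≤ Ncl t p → h p ≤ h' p) → weightedCost t h ≤ weightedCost t h'
weightedCost-mono-≤ t h≤h' =
  sumℚ-map-mono-≤ (leaves t) (λ {p} p∈ → ℕ→ℚ-*-monoʳ-≤ (Ncl t p) (h≤h' p (∈-leaves⁻ p∈)))

weightedCost-const : ∀ {L} (t : Tree L) (c : ℚ) → weightedCost t (const c) ≡ ℕ→ℚ (clients t) * c
weightedCost-const (leaf n) c = ℚP.+-identityʳ (ℕ→ℚ n * c)
weightedCost-const (node ts) c = begin
  weightedCost (node ts) (const c)            ≡⟨ weightedCost-node ts (const c) ⟩
  sum (λ i → weightedCost (ts i) (const c))   ≡⟨ sum-cong-≗ (λ i → weightedCost-const (ts i) c) ⟩
  sum (λ i → ℕ→ℚ (clients (ts i)) * c)        ≡⟨ *-distribʳ-sum c (ℕ→ℚ ∘ clients ∘ ts) ⟨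
  sum (λ i → ℕ→ℚ (clients (ts i))) * c        ≡⟨ cong (_* c) (ℕ→ℚ-clients-node ts) ⟨
  ℕ→ℚ (clients (node ts)) * c                 ∎
  where open ≡-Reasoning

weightedCost-*ˡ : ∀ {L} (t : Tree L) (c : ℚ) (h : Pos t → ℚ) →
  c * weightedCost t h ≡ weightedCost t (λ p → c * h p)
weightedCost-*ˡ t c h = trans (sym (sumℚ-map-*ˡ c _ (leaves t)))
  (cong sumℚ (ListP.map-cong (λ p → x∙yz≈y∙xz c (ℕ→ℚ (Ncl t p)) (h p)) (leaves t)))

0≤weightedCost : ∀ {L} (t : Tree L) {h : Pos t → ℚ} →
  (∀ p → lvl p ≡ 0 → 1 ℕ.≤ Ncl t p → 0ℚ ≤ h p) → 0ℚ ≤ weightedCost t h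
0≤weightedCost t 0≤h = begin
  0ℚ                            ≡⟨ ℚP.*-zeroʳ (ℕ→ℚ (clients t)) ⟨
  ℕ→ℚ (clients t) * 0ℚ          ≡⟨ weightedCost-const t 0ℚ ⟨
  weightedCost t (const 0ℚ)     ≤⟨ weightedCost-mono-≤ t 0≤h ⟩
  weightedCost t _              ∎
  where open ℚP.≤-Reasoning

module _ {lam : ℚ} (1≤lam : 1ℚ ≤ lam) where

  0≤lam^ : ∀ n → 0ℚ ≤ lam ^ℚ n
  0≤lam^ zero = 0≤1
  0≤lam^ (suc n) = 0≤* (ℚP.≤-trans 0≤1 1≤lam) (0≤lam^ n)

  lam^-≤-suc : ∀ n → lam ^ℚ n ≤ lam ^ℚ suc n
  lam^-≤-suc n =
    ℚP.≤-trans (ℚP.≤-reflexive (sym (ℚP.*-identityˡ (lam ^ℚ n)))) (*-monoʳ-≤-0≤ (0≤lam^ n) 1≤lam)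

  0≤lam-1 : 0ℚ ≤ lam - 1ℚ
  0≤lam-1 = ℚP.≤-trans (ℚP.≤-reflexive (sym (ℚP.+-inverseʳ 1ℚ))) (ℚP.+-monoˡ-≤ (- 1ℚ) 1≤lam)

  0≤rootDist : ∀ {L} (t : Tree L) (p : Pos t) → 0ℚ ≤ rootDist lam t p
  0≤rootDist t here = ℚP.≤-refl
  0≤rootDist (node {L} ts) (child i p) = ℚP.+-mono-≤ (0≤lam^ L) (0≤rootDist (ts i) p)

  lam^≤rootDist-child : ∀ {L k} {ts : Fin (suc k) → Tree L} (i : Fin (suc k)) (p : Pos (ts i)) →
    lam ^ℚ L ≤ rootDist lam (node ts) (child i p)
  lam^≤rootDist-child {ts = ts} i p = p≤p+q (0≤rootDist (ts i) p)

  lam-1*rootDist≤lam^ : ∀ {L} (t : Tree L) (p : Pos t) → (lam - 1ℚ) * rootDist lam t p ≤ lam ^ℚ L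
  lam-1*rootDist≤lam^ {L} t here = ℚP.≤-trans (ℚP.≤-reflexive (ℚP.*-zeroʳ (lam - 1ℚ))) (0≤lam^ L)
  lam-1*rootDist≤lam^ (node {L} ts) (child i p) = begin
    (lam - 1ℚ) * (lam ^ℚ L + rootDist lam (ts i) p)
      ≡⟨ ℚP.*-distribˡ-+ (lam - 1ℚ) (lam ^ℚ L) _ ⟩
    (lam - 1ℚ) * lam ^ℚ L + (lam - 1ℚ) * rootDist lam (ts i) p
      ≤⟨ ℚP.+-monoʳ-≤ ((lam - 1ℚ) * lam ^ℚ L) (lam-1*rootDist≤lam^ (ts i) p) ⟩
    (lam - 1ℚ) * lam ^ℚ L + lam ^ℚ L
      ≡⟨ telescope lam (lam ^ℚ L) ⟩
    lam * lam ^ℚ L ∎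
    where
    open ℚP.≤-Reasoning
    open +-*-Solver
    telescope : ∀ l x → (l - 1ℚ) * x + x ≡ l * x
    telescope = solve 2 (λ l x → (l :- con 1ℚ) :* x :+ x := l :* x) refl

  dist≤rootDist+rootDist : ∀ {L} (t : Tree L) (a b : Pos t) → dist lam t a b ≤ rootDist lam t a + rootDist lam t b
  dist≤rootDist+rootDist t here b = ℚP.≤-reflexive (sym (ℚP.+-identityˡ _))
  dist≤rootDist+rootDist t (child i p) here = ℚP.≤-reflexive (sym (ℚP.+-identityʳ _))
  dist≤rootDist+rootDist (node {L} ts) (child i p) (child j q) with i ≟ j
  ... | yes refl = ℚP.≤-trans (dist≤rootDist+rootDist (ts i) p q)
        (ℚP.+-mono-≤ (p≤q+p (0≤lam^ L)) (p≤q+p (0≤lam^ L)))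
  ... | no _ = ℚP.≤-refl

  lam-1*dist≤ : ∀ {L} (t : Tree L) (a b : Pos t) → (lam - 1ℚ) * dist lam t a b ≤ lam ^ℚ L + lam ^ℚ L
  lam-1*dist≤ {L} t a b = begin
    (lam - 1ℚ) * dist lam t a b
      ≤⟨ *-monoˡ-≤-0≤ 0≤lam-1 (dist≤rootDist+rootDist t a b) ⟩
    (lam - 1ℚ) * (rootDist lam t a + rootDist lam t b)
      ≡⟨ ℚP.*-distribˡ-+ (lam - 1ℚ) _ _ ⟩
    (lam - 1ℚ) * rootDist lam t a + (lam - 1ℚ) * rootDist lam t b
      ≤⟨ ℚP.+-mono-≤ (lam-1*rootDist≤lam^ t a) (lam-1*rootDist≤lam^ t b) ⟩
    lam ^ℚ L + lam ^ℚ L ∎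
    where open ℚP.≤-Reasoning

  0≤dist : ∀ {L} (t : Tree L) (a b : Pos t) → 0ℚ ≤ dist lam t a b
  0≤dist t here b = 0≤rootDist t b
  0≤dist t (child i p) here = 0≤rootDist t (child i p)
  0≤dist (node ts) (child i p) (child j q) with i ≟ j
  ... | yes refl = 0≤dist (ts i) p q
  ... | no _ = ℚP.+-mono-≤ (0≤rootDist (node ts) (child i p)) (0≤rootDist (node ts) (child j q))

  dist-child-child : ∀ {L k} (ts : Fin (suc k) → Tree L) (i : Fin (suc k)) (p q : Pos (ts i)) →
    dist lam (node ts) (child i p) (child i q) ≡ dist lam (ts i) p q
  dist-child-child ts i p q with i ≟ i
  ... | yes refl = refl
  ... | no i≢i = ⊥-elim (i≢i refl)

  dist-from-child : ∀ {L k} {ts : Fin (suc k) → Tree L} (i : Fin (suc k)) (p : Pos (ts i)) (s : Pos (node ts)) →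
    lam ^ℚ L ≤ dist lam (node ts) (child i p) s ⊎
    Σ (Pos (ts i)) (λ q → s ≡ child i q × dist lam (node ts) (child i p) s ≡ dist lam (ts i) p q)
  dist-from-child {ts = ts} i p here = inj₁ (lam^≤rootDist-child {ts = ts} i p)
  dist-from-child {ts = ts} i p (child j q) with i ≟ j
  ... | yes refl = inj₂ (q , refl , refl)
  ... | no _ =
    inj₁ (ℚP.≤-trans (lam^≤rootDist-child {ts = ts} i p) (p≤p+q (0≤rootDist (node ts) (child j q))))

-- distSet minimises with a where-local accumulator loop, which cannot be named directly.
-- distSetLoop is a hole solved by unification in distSet-∷-∷, where the with-abstraction
-- turns the problem into a pattern.
mutual
  distSetLoop : (lam : ℚ) → ∀ {L} (t : Tree L) (v s : Pos t) (ss : List (Pos t)) → ℚ → List (Pos t) → ℚ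
  distSetLoop lam t v s ss = _

  distSet-∷-∷ : (lam : ℚ) → ∀ {L} (t : Tree L) (v s x : Pos t) (xs : List (Pos t)) →
    distSet lam t v (s ∷ x ∷ xs) ≡ distSetLoop lam t v s (x ∷ xs) (dist lam t v s ⊓ dist lam t v x) xs
  distSet-∷-∷ lam t v s x xs with x ∷ xs | dist lam t v s ⊓ dist lam t v x
  ... | ss | m = refl

module _ (lam : ℚ) {L} (t : Tree L) (v s : Pos t) (ss : List (Pos t)) where
  private
    loop : ℚ → List (Pos t) → ℚ
    loop = distSetLoop lam t v s ss
    d : Pos t → ℚ
    d = dist lam t v

  loop-≤-acc : ∀ m xs → loop m xs ≤ m
  loop-≤-acc m [] = ℚP.≤-refl
  loop-≤-acc m (x ∷ xs) = ℚP.≤-trans (loop-≤-acc (m ⊓ d x) xs) (ℚP.p⊓q≤p m (d x))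

  loop-≤-∈ : ∀ m xs {y} → y ∈ xs → loop m xs ≤ d y
  loop-≤-∈ m (x ∷ xs) (here refl) = ℚP.≤-trans (loop-≤-acc (m ⊓ d x) xs) (ℚP.p⊓q≤q m (d x))
  loop-≤-∈ m (x ∷ xs) (there y∈xs) = loop-≤-∈ (m ⊓ d x) xs y∈xs

  loop-attained : ∀ m xs → loop m xs ≡ m ⊎ Σ (Pos t) (λ y → y ∈ xs × loop m xs ≡ d y)
  loop-attained m [] = inj₁ refl
  loop-attained m (x ∷ xs) with loop-attained (m ⊓ d x) xs | ℚP.⊓-sel m (d x)
  ... | inj₂ (y , y∈xs , eq) | _ = inj₂ (y , there y∈xs , eq)
  ... | inj₁ eq | inj₁ m⊓dx≡m = inj₁ (trans eq m⊓dx≡m)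
  ... | inj₁ eq | inj₂ m⊓dx≡dx = inj₂ (x , here refl , trans eq m⊓dx≡dx)

distSet-≤-∈ : ∀ lam {L} (t : Tree L) (v : Pos t) {S y} → y ∈ S → distSet lam t v S ≤ dist lam t v y
distSet-≤-∈ lam t v {s ∷ ss} (here refl) = loop-≤-acc lam t v s ss (dist lam t v s) ss
distSet-≤-∈ lam t v {s ∷ ss} (there y∈ss) = loop-≤-∈ lam t v s ss (dist lam t v s) ss y∈ss

distSet-attained : ∀ lam {L} (t : Tree L) (v : Pos t) {S} → S ≢ [] →
  Σ (Pos t) (λ y → y ∈ S × distSet lam t v S ≡ dist lam t v y)
distSet-attained lam t v {[]} []≢[] = ⊥-elim ([]≢[] refl)
distSet-attained lam t v {s ∷ ss} _ with loop-attained lam t v s ss (dist lam t v s) ss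
... | inj₁ eq = s , here refl , eq
... | inj₂ (y , y∈ss , eq) = y , there y∈ss , eq

distSet-nearestUsed : ∀ lam {L} (t : Tree L) (R : List (Pos t)) (p : Pos t) → lvl p ≡ 0 → 1 ℕ.≤ Ncl t p →
  ∀ {r} → r ∈ R → distSet lam t p (nearestUsed lam t R) ≤ dist lam t p r
distSet-nearestUsed lam t R p isLeaf isClient {r} r∈R =
  ℚP.≤-trans (distSet-≤-∈ lam t p y∈S) (All.lookup y-nearest r∈R)
  where
  y : Pos t
  y = argmin (dist lam t p) r R
  y-nearest : All (λ r' → dist lam t p y ≤ dist lam t p r') R
  y-nearest = f[argmin]≤f[xs] {f = dist lam t p} r R
  y∈R : y ∈ R
  y∈R = [ (λ y≡r → subst (_∈ R) (sym y≡r) r∈R) , id ]′ (argmin-sel (dist lam t p) r R)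
  y∈S : y ∈ nearestUsed lam t R
  y∈S = ∈P.∈-filter⁺ _ y∈R (lose (∈-leaves⁺ {p = p} isLeaf) (isClient , y-nearest))

restrict : ∀ {L k} {ts : Fin (suc k) → Tree L} (i : Fin (suc k)) → List (Pos (node ts)) → List (Pos (ts i))
restrict i [] = []
restrict i (here ∷ S) = restrict i S
restrict i (child j q ∷ S) with i ≟ j
... | yes refl = q ∷ restrict i S
... | no _ = restrict i S

module _ {L k} {ts : Fin (suc k) → Tree L} where

  ∈-restrict : ∀ (i : Fin (suc k)) {q : Pos (ts i)} {S : List (Pos (node ts))} →
    child i q ∈ S → q ∈ restrict i S
  ∈-restrict i {S = child j q ∷ S} (here refl) with i ≟ i
  ... | yes refl = here refl
  ... | no i≢i = ⊥-elim (i≢i refl)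
  ∈-restrict i {S = here ∷ S} (there q∈S) = ∈-restrict i q∈S
  ∈-restrict i {S = child j q ∷ S} (there q∈S) with i ≟ j
  ... | yes refl = there (∈-restrict i q∈S)
  ... | no _ = ∈-restrict i q∈S

  restrict-self : ∀ (j : Fin (suc k)) (q : Pos (ts j)) (S : List (Pos (node ts))) →
    restrict j (child j q ∷ S) ≡ q ∷ restrict j S
  restrict-self j q S with j ≟ j
  ... | yes refl = refl
  ... | no j≢j = ⊥-elim (j≢j refl)

  restrict-other : ∀ {i j : Fin (suc k)} (q : Pos (ts j)) (S : List (Pos (node ts))) → i ≢ j →
    restrict i (child j q ∷ S) ≡ restrict i S
  restrict-other {i} {j} q S i≢j with i ≟ j
  ... | yes i≡j = ⊥-elim (i≢j i≡j)
  ... | no _ = refl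

  ∑length-restrict≤length : ∀ (S : List (Pos (node ts))) →
    sum (λ i → ℕ→ℚ (length (restrict i S))) ≤ ℕ→ℚ (length S)
  ∑length-restrict≤length [] = ℚP.≤-reflexive (sum-replicate-zero (suc k))
  ∑length-restrict≤length (here ∷ S) =
    ℚP.≤-trans (∑length-restrict≤length S) (ℕ→ℚ-mono-≤ (ℕP.n≤1+n (length S)))
  ∑length-restrict≤length (child j q ∷ S) = begin
    sum counts′                                   ≡⟨ sum-remove {i = j} counts′ ⟩
    counts′ j + sum (removeAt counts′ j)          ≡⟨ cong₂ _+_ own-subtree other-subtrees ⟩
    (1ℚ + counts j) + sum (removeAt counts j)     ≡⟨ ℚP.+-assoc 1ℚ (counts j) _ ⟩
    1ℚ + (counts j + sum (removeAt counts j))     ≡⟨ cong (1ℚ +_) (sum-remove {i = j} counts) ⟨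
    1ℚ + sum counts                               ≤⟨ ℚP.+-monoʳ-≤ 1ℚ (∑length-restrict≤length S) ⟩
    1ℚ + ℕ→ℚ (length S)                           ≡⟨ ℕ→ℚ-+ 1 (length S) ⟨
    ℕ→ℚ (length (child j q ∷ S))                  ∎
    where
    open ℚP.≤-Reasoning
    counts counts′ : Fin (suc k) → ℚ
    counts i = ℕ→ℚ (length (restrict i S))
    counts′ i = ℕ→ℚ (length (restrict i (child j q ∷ S)))
    own-subtree : counts′ j ≡ 1ℚ + counts j
    own-subtree = trans (cong (ℕ→ℚ ∘ length) (restrict-self j q S)) (ℕ→ℚ-+ 1 (length (restrict j S)))
    other-subtrees : sum (removeAt counts′ j) ≡ sum (removeAt counts j)
    other-subtrees = sum-cong-≗ (λ i → cong (ℕ→ℚ ∘ length) (restrict-other q S (punchInᵢ≢i j i)))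

module Facility (lam f : ℚ) (L' : ℕ) where

  InMinSet : ∀ {L} (t : Tree L) → Pos t → Set
  InMinSet t u = InM lam f L' t u × All (λ w → ¬ InM lam f L' t w) (strictDesc u)

  inMinSet? : ∀ {L} (t : Tree L) (u : Pos t) → Dec (InMinSet t u)
  inMinSet? t u = inM? lam f L' t u ×-dec All.all? (λ w → ¬? (inM? lam f L' t w)) (strictDesc u)

  InMinSet⇒∈minSetM : ∀ {L} (t : Tree L) {r : Pos t} → InMinSet t r → r ∈ minSetM lam f L' t
  InMinSet⇒∈minSetM t {r} = ∈P.∈-filter⁺ (inMinSet? t) (∈-allPos t r)

  InMinSet-child : ∀ {L k} {ts : Fin (suc k) → Tree L} (i : Fin (suc k)) {r : Pos (ts i)} →
    InMinSet (ts i) r → InMinSet (node ts) (child i r)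
  InMinSet-child i (r∈M , below-r∉M) = r∈M , AllP.map⁺ below-r∉M

  InM⇒∃InMinSet : ∀ {L} (t : Tree L) (q : Pos t) → InM lam f L' t q → Σ (Pos t) (InMinSet t)
  InM⇒∃InMinSet (leaf n) here q∈M = here , q∈M , []
  InM⇒∃InMinSet (node {k = k} ts) q q∈M
    with any? (λ i → any? (inM? lam f L' (ts i)) (allPos (ts i))) (allFin (suc k))
  ... | yes M∩children with satisfied M∩children
  ...   | i , M∩ts-i with satisfied M∩ts-i
  ...     | q′ , q′∈M with InM⇒∃InMinSet (ts i) q′ q′∈M
  ...       | r , r∈min = child i r , InMinSet-child i {r} r∈min
  InM⇒∃InMinSet (node {k = k} ts) q q∈M | no M∩children=∅ = here , root∈M q q∈M , below-root∉M
    where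
    child∉M : ∀ i (q′ : Pos (ts i)) → ¬ InM lam f L' (node ts) (child i q′)
    child∉M i q′ q′∈M = M∩children=∅ (lose (∈P.∈-allFin i) (lose (∈-allPos (ts i) q′) q′∈M))
    root∈M : ∀ q → InM lam f L' (node ts) q → InM lam f L' (node ts) here
    root∈M here q∈M = q∈M
    root∈M (child i q′) q′∈M = ⊥-elim (child∉M i q′ q′∈M)
    subtree : (i : Fin (suc k)) → List (Pos (node ts))
    subtree i = map (child i) (allPos (ts i))
    below-root∉M : All (λ w → ¬ InM lam f L' (node ts) w) (properPos (node ts))
    below-root∉M = AllP.concat⁺ {xss = map subtree (allFin (suc k))} (AllP.map⁺ {f = subtree}
      (All.tabulate (λ {i} _ → AllP.map⁺ {f = child i} (All.tabulate (λ {q′} _ → child∉M i q′)))))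

  mutual
    Φ : ∀ {L} → Tree L → ℚ
    Φ (leaf _) = 0ℚ
    Φ (node ts) = sum (λ i → Φ-child (ts i) (inM? lam f L' (ts i) here))

    Φ-child : ∀ {L} (t : Tree L) → Dec (InM lam f L' t here) → ℚ
    Φ-child t (yes _) = Φ t
    Φ-child {L} t (no _) = ℕ→ℚ (clients t) * lam ^ℚ L

  cost : ∀ {L} (t : Tree L) → List (Pos t) → (Pos t → ℚ) → ℚ
  cost t S h = ℕ→ℚ (length S) * f + weightedCost t h

  -- lam^L is the weight of the edge above the root of t, so h may also pay for a facility outside t.
  Covers : ∀ {L} (t : Tree L) → List (Pos t) → (Pos t → ℚ) → Set
  Covers {L} t S h = ∀ p → lvl p ≡ 0 → 1 ℕ.≤ Ncl t p →
    lam ^ℚ L ≤ h p ⊎ Σ (Pos t) (λ s → s ∈ S × dist lam t p s ≤ h p)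

  NearestBound : ∀ {L} (t : Tree L) → (Pos t → ℚ) → Set
  NearestBound t h = ∀ p → lvl p ≡ 0 → 1 ℕ.≤ Ncl t p → ∀ r → InMinSet t r → h p ≤ dist lam t p r

  NearestBound-nearestUsed : ∀ {L} (t : Tree L) →
    NearestBound t (λ p → distSet lam t p (nearestUsed lam t (minSetM lam f L' t)))
  NearestBound-nearestUsed t p isLeaf isClient r r∈min =
    distSet-nearestUsed lam t (minSetM lam f L' t) p isLeaf isClient (InMinSet⇒∈minSetM t r∈min)

  Covers-distSet : ∀ {L} (t : Tree L) (S : List (Pos t)) → S ≢ [] ⊎ clients t ≡ 0 →
    Covers t S (λ p → distSet lam t p S)
  Covers-distSet t S (inj₁ S≢[]) p _ _ with distSet-attained lam t p S≢[]
  ... | y , y∈S , d≡d = inj₂ (y , y∈S , ℚP.≤-reflexive (sym d≡d))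
  Covers-distSet t S (inj₂ no-clients) p _ isClient =
    ⊥-elim (ℕP.<⇒≱ isClient (subst (Ncl t p ℕ.≤_) no-clients (Ncl≤clients t p)))

  module _ (1≤lam : 1ℚ ≤ lam) (0≤f : 0ℚ ≤ f) where

    Covers⇒0≤ : ∀ {L} (t : Tree L) {S h} → Covers t S h → ∀ p → lvl p ≡ 0 → 1 ℕ.≤ Ncl t p → 0ℚ ≤ h p
    Covers⇒0≤ {L} t covers p isLeaf isClient with covers p isLeaf isClient
    ... | inj₁ lam^≤h = ℚP.≤-trans (0≤lam^ 1≤lam L) lam^≤h
    ... | inj₂ (s , _ , d≤h) = ℚP.≤-trans (0≤dist 1≤lam t p s) d≤h

    0≤cost : ∀ {L} (t : Tree L) {S h} → Covers t S h → 0ℚ ≤ cost t S h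
    0≤cost t {S} covers = ℚP.+-mono-≤ (0≤* (0≤ℕ→ℚ (length S)) 0≤f) (0≤weightedCost t (Covers⇒0≤ t covers))

    Covers-restrict : ∀ {L k} {ts : Fin (suc k) → Tree L} {S h} (i : Fin (suc k)) →
      Covers (node ts) S h → Covers (ts i) (restrict i S) (h ∘ child i)
    Covers-restrict {L} {h = h} i covers p isLeaf isClient with covers (child i p) isLeaf isClient
    ... | inj₁ lam^suc≤h = inj₁ (ℚP.≤-trans (lam^-≤-suc 1≤lam L) lam^suc≤h)
    ... | inj₂ (s , s∈S , d≤h) with dist-from-child 1≤lam i p s
    ...   | inj₁ lam^≤d = inj₁ (ℚP.≤-trans lam^≤d d≤h)
    ...   | inj₂ (q , refl , d≡d′) = inj₂ (q , ∈-restrict i s∈S , subst (_≤ h (child i p)) d≡d′ d≤h)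

    -- Either S opens a facility in t, costing f, or every client of t pays lam^L to leave t.
    clients*lam^≤cost : ∀ {L} (t : Tree L) (S : List (Pos t)) {h} → ℕ→ℚ (clients t) * lam ^ℚ L < f →
      Covers t S h → ℕ→ℚ (clients t) * lam ^ℚ L ≤ cost t S h
    clients*lam^≤cost {L} t [] {h} _ covers = begin
      ℕ→ℚ (clients t) * lam ^ℚ L       ≡⟨ weightedCost-const t (lam ^ℚ L) ⟨
      weightedCost t (const (lam ^ℚ L)) ≤⟨ weightedCost-mono-≤ t lam^≤h ⟩
      weightedCost t h                  ≡⟨ ℚP.+-identityˡ (weightedCost t h) ⟨
      0ℚ + weightedCost t h             ≡⟨ cong (_+ weightedCost t h) (ℚP.*-zeroˡ f) ⟨
      cost t [] h                       ∎
      where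
      open ℚP.≤-Reasoning
      lam^≤h : ∀ p → lvl p ≡ 0 → 1 ℕ.≤ Ncl t p → lam ^ℚ L ≤ h p
      lam^≤h p isLeaf isClient with covers p isLeaf isClient
      ... | inj₁ lam^≤h = lam^≤h
      ... | inj₂ (_ , () , _)
    clients*lam^≤cost {L} t (s ∷ S) {h} N*lam^<f covers = begin
      ℕ→ℚ (clients t) * lam ^ℚ L                      <⟨ N*lam^<f ⟩
      f                                                ≡⟨ ℚP.*-identityˡ f ⟨
      1ℚ * f                                           ≤⟨ *-monoʳ-≤-0≤ 0≤f (ℕ→ℚ-mono-≤ (ℕ.s≤s (ℕ.z≤n {length S}))) ⟩
      ℕ→ℚ (length (s ∷ S)) * f                         ≤⟨ p≤p+q (0≤weightedCost t (Covers⇒0≤ t covers)) ⟩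
      cost t (s ∷ S) h                                 ∎
      where open ℚP.≤-Reasoning

    ∑cost-restrict≤cost : ∀ {L k} (ts : Fin (suc k) → Tree L) (S : List (Pos (node ts)))
      (h : Pos (node ts) → ℚ) → sum (λ i → cost (ts i) (restrict i S) (h ∘ child i)) ≤ cost (node ts) S h
    ∑cost-restrict≤cost ts S h = begin
      sum (λ i → ℕ→ℚ (length (restrict i S)) * f + weightedCost (ts i) (h ∘ child i))
        ≡⟨ ∑-distrib-+ (λ i → ℕ→ℚ (length (restrict i S)) * f) (λ i → weightedCost (ts i) (h ∘ child i)) ⟩
      sum (λ i → ℕ→ℚ (length (restrict i S)) * f) + sum (λ i → weightedCost (ts i) (h ∘ child i))
        ≡⟨ cong₂ _+_ (*-distribʳ-sum f (λ i → ℕ→ℚ (length (restrict i S)))) (weightedCost-node ts h) ⟨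
      sum (λ i → ℕ→ℚ (length (restrict i S))) * f + weightedCost (node ts) h
        ≤⟨ ℚP.+-monoˡ-≤ (weightedCost (node ts) h) (*-monoʳ-≤-0≤ 0≤f (∑length-restrict≤length S)) ⟩
      cost (node ts) S h ∎
      where open ℚP.≤-Reasoning

    Φ≤cost : ∀ {L} (t : Tree L) (S : List (Pos t)) (h : Pos t → ℚ) → Covers t S h → Φ t ≤ cost t S h
    Φ≤cost (leaf n) S h covers = 0≤cost (leaf n) covers
    Φ≤cost (node ts) S h covers =
      ℚP.≤-trans (sum-mono-≤ (λ i → Φ-child≤cost i (inM? lam f L' (ts i) here))) (∑cost-restrict≤cost ts S h)
      where
      Φ-child≤cost : ∀ i (dec : Dec (InM lam f L' (ts i) here)) →
        Φ-child (ts i) dec ≤ cost (ts i) (restrict i S) (h ∘ child i)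
      Φ-child≤cost i (yes _) = Φ≤cost (ts i) (restrict i S) (h ∘ child i) (Covers-restrict i covers)
      Φ-child≤cost i (no ts-i∉M) =
        clients*lam^≤cost (ts i) (restrict i S) (ℚP.≰⇒> (ts-i∉M ∘ inj₂)) (Covers-restrict i covers)

  module _ (1≤lam : 1ℚ ≤ lam) where

    NearestBound-child : ∀ {L k} {ts : Fin (suc k) → Tree L} {h} (i : Fin (suc k)) →
      NearestBound (node ts) h → NearestBound (ts i) (h ∘ child i)
    NearestBound-child {ts = ts} {h} i nearest p isLeaf isClient r r∈min =
      subst (h (child i p) ≤_) (dist-child-child 1≤lam ts i p r)
        (nearest (child i p) isLeaf isClient (child i r) (InMinSet-child i {r} r∈min))

    lam-1*weightedCost-child≤ : ∀ {L k} (ts : Fin (suc k) → Tree L) {h} → InM lam f L' (node ts) here →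
      NearestBound (node ts) h → ∀ i →
      (lam - 1ℚ) * weightedCost (ts i) (h ∘ child i) ≤ (lam + lam) * (ℕ→ℚ (clients (ts i)) * lam ^ℚ L)
    lam-1*weightedCost-child≤ {L} ts {h} root∈M nearest i = begin
      (lam - 1ℚ) * weightedCost (ts i) (h ∘ child i)
        ≡⟨ weightedCost-*ˡ (ts i) (lam - 1ℚ) (h ∘ child i) ⟩
      weightedCost (ts i) (λ p → (lam - 1ℚ) * h (child i p))
        ≤⟨ weightedCost-mono-≤ (ts i) to-r ⟩
      weightedCost (ts i) (const ((lam + lam) * lam ^ℚ L))
        ≡⟨ weightedCost-const (ts i) ((lam + lam) * lam ^ℚ L) ⟩
      ℕ→ℚ (clients (ts i)) * ((lam + lam) * lam ^ℚ L)
        ≡⟨ x∙yz≈y∙xz (ℕ→ℚ (clients (ts i))) (lam + lam) (lam ^ℚ L) ⟩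
      (lam + lam) * (ℕ→ℚ (clients (ts i)) * lam ^ℚ L) ∎
      where
      open ℚP.≤-Reasoning
      min-vertex : Σ (Pos (node ts)) (InMinSet (node ts))
      min-vertex = InM⇒∃InMinSet (node ts) here root∈M
      r : Pos (node ts)
      r = proj₁ min-vertex
      to-r : ∀ p → lvl p ≡ 0 → 1 ℕ.≤ Ncl (ts i) p → (lam - 1ℚ) * h (child i p) ≤ (lam + lam) * lam ^ℚ L
      to-r p isLeaf isClient = begin
        (lam - 1ℚ) * h (child i p)
          ≤⟨ *-monoˡ-≤-0≤ (0≤lam-1 1≤lam) (nearest (child i p) isLeaf isClient r (proj₂ min-vertex)) ⟩
        (lam - 1ℚ) * dist lam (node ts) (child i p) r
          ≤⟨ lam-1*dist≤ 1≤lam (node ts) (child i p) r ⟩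
        lam * lam ^ℚ L + lam * lam ^ℚ L
          ≡⟨ ℚP.*-distribʳ-+ (lam ^ℚ L) lam lam ⟨
        (lam + lam) * lam ^ℚ L ∎

    lam-1*weightedCost≤Φ : ∀ {L} (t : Tree L) (h : Pos t → ℚ) → InM lam f L' t here → NearestBound t h →
      (lam - 1ℚ) * weightedCost t h ≤ (lam + lam) * Φ t
    lam-1*weightedCost≤Φ (leaf n) h root∈M nearest = begin
      (lam - 1ℚ) * (ℕ→ℚ n * h here + 0ℚ)
        ≤⟨ *-monoˡ-≤-0≤ (0≤lam-1 1≤lam) (ℚP.+-monoˡ-≤ 0ℚ (ℕ→ℚ-*-monoʳ-≤ n h≤0)) ⟩
      (lam - 1ℚ) * (ℕ→ℚ n * 0ℚ + 0ℚ)
        ≡⟨ cong (λ x → (lam - 1ℚ) * (x + 0ℚ)) (ℚP.*-zeroʳ (ℕ→ℚ n)) ⟩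
      (lam - 1ℚ) * 0ℚ
        ≡⟨ trans (ℚP.*-zeroʳ (lam - 1ℚ)) (sym (ℚP.*-zeroʳ (lam + lam))) ⟩
      (lam + lam) * 0ℚ ∎
      where
      open ℚP.≤-Reasoning
      h≤0 : 1 ℕ.≤ n → h here ≤ 0ℚ
      h≤0 isClient = nearest here refl isClient here (root∈M , [])
    lam-1*weightedCost≤Φ (node ts) h root∈M nearest = begin
      (lam - 1ℚ) * weightedCost (node ts) h
        ≡⟨ cong ((lam - 1ℚ) *_) (weightedCost-node ts h) ⟩
      (lam - 1ℚ) * sum (λ i → weightedCost (ts i) (h ∘ child i))
        ≡⟨ *-distribˡ-sum (lam - 1ℚ) (λ i → weightedCost (ts i) (h ∘ child i)) ⟩
      sum (λ i → (lam - 1ℚ) * weightedCost (ts i) (h ∘ child i))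
        ≤⟨ sum-mono-≤ (λ i → child-bound i (inM? lam f L' (ts i) here)) ⟩
      sum (λ i → (lam + lam) * Φ-child (ts i) (inM? lam f L' (ts i) here))
        ≡⟨ *-distribˡ-sum (lam + lam) (λ i → Φ-child (ts i) (inM? lam f L' (ts i) here)) ⟨
      (lam + lam) * Φ (node ts) ∎
      where
      open ℚP.≤-Reasoning
      child-bound : ∀ i (dec : Dec (InM lam f L' (ts i) here)) →
        (lam - 1ℚ) * weightedCost (ts i) (h ∘ child i) ≤ (lam + lam) * Φ-child (ts i) dec
      child-bound i (yes ts-i∈M) = lam-1*weightedCost≤Φ (ts i) (h ∘ child i) ts-i∈M (NearestBound-child i nearest)
      child-bound i (no _) = lam-1*weightedCost-child≤ ts root∈M nearest i

connCost-nearestUsed≤ : ∀ {lam f : ℚ} {L L'} → 1ℚ ≤ lam → 0ℚ ≤ f → (T : Tree L) → L' ℕ.≤ L →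
  (S* : List (Pos T)) → S* ≢ [] ⊎ clients T ≡ 0 →
  (lam - 1ℚ) * connCost lam T (nearestUsed lam T (minSetM lam f L' T)) ≤ (lam + lam) * facCost lam f T S*
connCost-nearestUsed≤ {lam} {f} {L' = L'} 1≤lam 0≤f T L'≤L S* S*-ok = begin
  (lam - 1ℚ) * connCost lam T (nearestUsed lam T (minSetM lam f L' T))
    ≤⟨ lam-1*weightedCost≤Φ 1≤lam T _ (inj₁ L'≤L) (NearestBound-nearestUsed T) ⟩
  (lam + lam) * Φ T
    ≤⟨ *-monoˡ-≤-0≤ 0≤lam+lam (Φ≤cost 1≤lam 0≤f T S* _ (Covers-distSet T S* S*-ok)) ⟩
  (lam + lam) * facCost lam f T S* ∎
  where
  open ℚP.≤-Reasoning
  open Facility lam f L'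
  0≤lam+lam : 0ℚ ≤ lam + lam
  0≤lam+lam = ℚP.+-mono-≤ (ℚP.≤-trans 0≤1 1≤lam) (ℚP.≤-trans 0≤1 1≤lam)

IsLPrime⇒≤ : ∀ lam ε f {L L'} → ε * f ≤ lam ^ℚ L → IsLPrime lam ε f L' → L' ℕ.≤ L
IsLPrime⇒≤ lam ε f {L} εf≤lam^L (_ , L'-least) = ℕP.≮⇒≥ (λ L<L' → L'-least L L<L' εf≤lam^L)

lemma2 : (lam : ℚ) → 1ℚ < lam →
    ∃[ C ] ((ε f : ℚ) → 0ℚ < ε → 0ℚ < f →
      (L : ℕ) (T : Tree L) → ε * f ≤ lam ^ℚ L →
      (L' : ℕ) → IsLPrime lam ε f L' →
      (S* : List (Pos T)) → (S* ≢ [] ⊎ clients T ≡ 0) →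
      connCost lam T (nearestUsed lam T (minSetM lam f L' T)) ≤ C * facCost lam f T S*)
lemma2 lam 1<lam = 1/ (lam - 1ℚ) * (lam + lam) ,
  λ ε f _ 0<f L T εf≤lam^L L' L'-prime S* S*-ok →
    ℚP.*-cancelˡ-≤-pos (lam - 1ℚ) (ℚP.≤-trans
      (connCost-nearestUsed≤ (ℚP.<⇒≤ 1<lam) (ℚP.<⇒≤ 0<f) T (IsLPrime⇒≤ lam ε f εf≤lam^L L'-prime) S* S*-ok)
      (ℚP.≤-reflexive (cancel-lam-1 (facCost lam f T S*))))
  where
  instance
    lam-1-pos : Positive (lam - 1ℚ)
    lam-1-pos = positive (ℚP.+-monoˡ-< (- 1ℚ) 1<lam)
    lam-1-nonZero : NonZero (lam - 1ℚ)
    lam-1-nonZero = ℚP.pos⇒nonZero (lam - 1ℚ)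
  cancel-lam-1 : ∀ x → (lam + lam) * x ≡ (lam - 1ℚ) * (1/ (lam - 1ℚ) * (lam + lam) * x)
  cancel-lam-1 x = begin
    (lam + lam) * x                                       ≡⟨ ℚP.*-identityˡ ((lam + lam) * x) ⟨
    1ℚ * ((lam + lam) * x)                                ≡⟨ cong (_* ((lam + lam) * x)) (ℚP.*-inverseʳ (lam - 1ℚ)) ⟨
    ((lam - 1ℚ) * 1/ (lam - 1ℚ)) * ((lam + lam) * x)      ≡⟨ ℚP.*-assoc (lam - 1ℚ) _ _ ⟩
    (lam - 1ℚ) * (1/ (lam - 1ℚ) * ((lam + lam) * x))      ≡⟨ cong ((lam - 1ℚ) *_) (ℚP.*-assoc (1/ (lam - 1ℚ)) (lam + lam) x) ⟨
    (lam - 1ℚ) * (1/ (lam - 1ℚ) * (lam + lam) * x)        ∎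
    where open ≡-Reasoning
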